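{- Let $n,k$ be integers with $n \ge k>n/2$. Then $$M_2(n,k) \ge n-1-\mu\left(\sum_{i=k}^n{n \choose i}\right).$$
   Context: There are $n$ balls, each colored with one of $2$ colors. A query is a pair of balls, and its answer tells whether the two balls have the same color. A ball is a $k$-majority ball if its color class has at least $k$ balls. $M_2(n,k)$ is the minimum number of queries in the worst case of an adaptive strategy (each query may depend on previous answers) that determines whether a $k$-majority color exists and, if so, exhibits a ball of that color. For a positive integer $m$, $\mu(m)$ denotes the largest integer $l$ such that $2^l$ divides $m$. -}

module Defs where

open import Data.Nat using (ℕ; zero; suc; _+_; _∸_; _^_; _≤_; _<_)
open import Data.Nat.Divisibility using (_∣_)
open import Data.Nat.Combinatorics using (_C_)
open import Data.Bool using (Bool; if_then_else_)
open import Data.Bool.Properties using () renaming (_≟_ to _≟ᵇ_)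
open import Data.Fin using (Fin)
open import Data.Nat.ListAction using (sum)
open import Data.List using (List; map; upTo; filter; length; allFin)
open import Data.Product using (_×_; ∃)
open import Relation.Nullary using (does)

Coloring : ℕ → Set
Coloring n = Fin n → Bool

count : {n : ℕ} → Coloring n → Bool → ℕ
count {n} c x = length (filter (λ i → c i ≟ᵇ x) (allFin n))

same : {n : ℕ} → Coloring n → Fin n → Fin n → Bool
same c i j = does (c i ≟ᵇ c j)

data Output (n : ℕ) : Set where
  noMajority : Output n
  majorityBall : Fin n → Output n

-- Adaptive strategies = decision trees.  'ask i j t f' queries the pair
-- (i , j) and continues with t if they have the same colour, f otherwise.
data Strategy (n : ℕ) : Set where
  leaf : Output n → Strategy n
  ask  : Fin n → Fin n → Strategy n → Strategy n → Strategy n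

run : {n : ℕ} → Strategy n → Coloring n → Output n
run (leaf o) c = o
run (ask i j t f) c = if same c i j then run t c else run f c

cost : {n : ℕ} → Strategy n → Coloring n → ℕ
cost (leaf o) c = 0
cost (ask i j t f) c = suc (if same c i j then cost t c else cost f c)

CorrectOutput : {n : ℕ} → ℕ → Coloring n → Output n → Set
CorrectOutput k c noMajority = (x : Bool) → count c x < k
CorrectOutput k c (majorityBall b) = k ≤ count c (c b)

Solves : {n : ℕ} → ℕ → Strategy n → Set
Solves k T = ∀ c → CorrectOutput k c (run T c)

-- "M₂(n,k) ≥ m": every correct strategy needs at least m queries on
-- some colouring (i.e. its worst-case number of queries is ≥ m).
M₂≥ : ℕ → ℕ → ℕ → Set
M₂≥ n k m = (T : Strategy n) → Solves k T →
  ∃ λ (c : Coloring n) → m ≤ cost T c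

IsMu : ℕ → ℕ → Set
IsMu m l = (2 ^ l ∣ m) × (∀ l' → 2 ^ l' ∣ m → l' ≤ l)

-- ∑_{i=k}^{n} (n choose i)   (for k ≤ n)
binomTail : ℕ → ℕ → ℕ
binomTail n k = sum (map (λ i → n C (k + i)) (upTo (suc (n ∸ k))))

-- A query reveals one linear relation c x + c y over GF(2), so a strategy asking at most
-- m − e questions on every colouring of m balls leaves at least e free coordinates at each
-- leaf.  Hence, summed over all 2^m colourings, the output "reports a ball" is divisible by
-- 2^e.  Eliminating the ball y through the first query (x , y) turns the two halves of
-- the colourings into all colourings of the remaining m − 1 balls, at the price of
-- queries of the more general form c a + c b + β; on these parity trees the divisibility
-- follows by induction.  For k > n/2 a correct strategy reports a ball exactly when one of
-- the two colours has at least k balls, and at most one colour does, so the sum equals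
-- 2 ∑_{i ≥ k} (n choose i).  A strategy with fewer than n − 1 − μ queries everywhere would
-- give 2^(μ+2) ∣ 2 ∑_{i ≥ k} (n choose i), contradicting the maximality of μ.

module Submission where

open import Defs
open import Data.Nat using (ℕ; zero; suc; _+_; _∸_; _*_; _^_; _≤_; _<_; z≤n; s≤s; _≤?_)
open import Data.Nat.Properties
open import Data.Nat.Divisibility using (_∣_; ∣m∣n⇒∣m+n; ∣m⇒∣m*n; m∣m*n; *-cancelˡ-∣)
open import Data.Nat.Combinatorics using (_C_; nCk+nC[k+1]≡[n+1]C[k+1]; k>n⇒nCk≡0)
open import Data.Nat.ListAction using (sum)
open import Data.Bool using (Bool; true; false; not; _xor_; if_then_else_)
open import Data.Bool.Properties
  using (xor-assoc; xor-same; xor-inverseˡ; xor-identityʳ; not-distribʳ-xor; if-float; xor-∧-commutativeRing)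
  renaming (_≟_ to _≟ᵇ_)
open import Data.Fin using (Fin; zero; suc; punchIn; punchOut) renaming (_≟_ to _≟ᶠ_)
open import Data.Fin.Properties using (punchIn-punchOut)
open import Data.Vec.Functional using ([]; _∷_; tail; insertAt)
open import Data.Vec.Functional.Properties using (insertAt-lookup; insertAt-punchIn)
open import Data.List using (map; applyUpTo; filter; length; tabulate)
open import Data.Product using (_×_; _,_; proj₁; proj₂; ∃)
open import Data.Sum using (_⊎_; inj₁; inj₂)
open import Data.Empty using (⊥-elim)
open import Function using (_∘_)
open import Relation.Nullary using (does; Dec; yes; no)
open import Relation.Nullary.Decidable using (dec-true; dec-false; map′; _⊎-dec_)
open import Relation.Binary.PropositionalEquality
  using (_≡_; _≢_; _≗_; refl; sym; trans; cong; cong₂; subst; module ≡-Reasoning)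
open import Algebra.Bundles using (CommutativeRing)
open import Algebra.Properties.CommutativeSemigroup +-commutativeSemigroup
  using () renaming (interchange to +-interchange)
open import Algebra.Properties.CommutativeSemigroup
  (CommutativeRing.+-commutativeSemigroup xor-∧-commutativeRing)
  using () renaming (interchange to xor-interchange)

if-cong : ∀ {A : Set} {b b′ : Bool} {x x′ y y′ : A} → b ≡ b′ → x ≡ x′ → y ≡ y′ →
          (if b then x else y) ≡ (if b′ then x′ else y′)
if-cong refl refl refl = refl

𝟙 : Bool → ℕ
𝟙 true = 1
𝟙 false = 0

∷-cong : ∀ {m} b {c d : Coloring m} → c ≗ d → (b ∷ c) ≗ (b ∷ d)
∷-cong b c≗d zero = refl
∷-cong b c≗d (suc i) = c≗d i

sumOver : (m : ℕ) → (Coloring m → ℕ) → ℕ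
sumOver zero g = g []
sumOver (suc m) g = sumOver m (g ∘ (true ∷_)) + sumOver m (g ∘ (false ∷_))

sumOver-cong : ∀ m {g h : Coloring m → ℕ} → g ≗ h → sumOver m g ≡ sumOver m h
sumOver-cong zero g≗h = g≗h []
sumOver-cong (suc m) g≗h =
  cong₂ _+_ (sumOver-cong m (g≗h ∘ (true ∷_))) (sumOver-cong m (g≗h ∘ (false ∷_)))

sumOver-+ : ∀ m (g h : Coloring m → ℕ) → sumOver m (λ c → g c + h c) ≡ sumOver m g + sumOver m h
sumOver-+ zero g h = refl
sumOver-+ (suc m) g h =
  trans (cong₂ _+_ (sumOver-+ m _ _) (sumOver-+ m _ _))
        (+-interchange (sumOver m (g ∘ (true ∷_))) (sumOver m (h ∘ (true ∷_)))
                       (sumOver m (g ∘ (false ∷_))) (sumOver m (h ∘ (false ∷_))))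

sumOver-∷ : ∀ m x (g : Coloring (suc m) → ℕ) →
  sumOver (suc m) g ≡ sumOver m (g ∘ (x ∷_)) + sumOver m (g ∘ (not x ∷_))
sumOver-∷ m true g = refl
sumOver-∷ m false g = +-comm (sumOver m (g ∘ (true ∷_))) (sumOver m (g ∘ (false ∷_)))

sumOver-const : ∀ m r → sumOver m (λ _ → r) ≡ 2 ^ m * r
sumOver-const zero r = sym (+-identityʳ r)
sumOver-const (suc m) r = begin
  sumOver m (λ _ → r) + sumOver m (λ _ → r) ≡⟨ cong (λ s → s + s) (sumOver-const m r) ⟩
  2 ^ m * r + 2 ^ m * r                     ≡⟨ cong (2 ^ m * r +_) (sym (+-identityʳ (2 ^ m * r))) ⟩
  2 * (2 ^ m * r)                           ≡⟨ sym (*-assoc 2 (2 ^ m) r) ⟩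
  2 ^ suc m * r                             ∎
  where open ≡-Reasoning

2^e∣sumOver-const : ∀ {e m} r → e ≤ m → 2 ^ e ∣ sumOver m (λ _ → r)
2^e∣sumOver-const {e} {m} r e≤m = subst (2 ^ e ∣_) (sym (trans (sumOver-const m r) 2^m≡))
  (∣m⇒∣m*n r (m∣m*n (2 ^ (m ∸ e))))
  where
  2^m≡ : 2 ^ m * r ≡ 2 ^ e * 2 ^ (m ∸ e) * r
  2^m≡ = cong (_* r) (trans (cong (2 ^_) (sym (m+[n∸m]≡n e≤m))) (^-distribˡ-+-* 2 e (m ∸ e)))

-- insertAt c y v and the colourings built with _∷_ agree only pointwise, hence the
-- extensionality hypothesis on g.
sumOver-insertAt : ∀ m (y : Fin (suc m)) (g : Coloring (suc m) → ℕ) →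
  (∀ {c d} → c ≗ d → g c ≡ g d) →
  sumOver (suc m) g ≡ sumOver m (λ c → g (insertAt c y true)) + sumOver m (λ c → g (insertAt c y false))
sumOver-insertAt m zero g g-resp =
  cong₂ _+_ (sumOver-cong m (λ c → g-resp λ { zero → refl ; (suc i) → refl }))
            (sumOver-cong m (λ c → g-resp λ { zero → refl ; (suc i) → refl }))
sumOver-insertAt (suc m) (suc y) g g-resp = begin
  sumOver (suc m) (g ∘ (true ∷_)) + sumOver (suc m) (g ∘ (false ∷_))
    ≡⟨ cong₂ _+_ (sumOver-insertAt m y _ (g-resp ∘ ∷-cong true))
                 (sumOver-insertAt m y _ (g-resp ∘ ∷-cong false)) ⟩
  (A true true + A true false) + (A false true + A false false)
    ≡⟨ +-interchange (A true true) (A true false) (A false true) (A false false) ⟩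
  (A true true + A false true) + (A true false + A false false)
    ≡⟨ cong₂ _+_ (cong₂ _+_ (A-insertAt true true) (A-insertAt false true))
                 (cong₂ _+_ (A-insertAt true false) (A-insertAt false false)) ⟨
  sumOver (suc m) (λ c → g (insertAt c (suc y) true)) + sumOver (suc m) (λ c → g (insertAt c (suc y) false)) ∎
  where
  open ≡-Reasoning
  A : Bool → Bool → ℕ
  A b v = sumOver m (λ c → g (b ∷ insertAt c y v))
  A-insertAt : ∀ b v → sumOver m (λ c → g (insertAt (b ∷ c) (suc y) v)) ≡ A b v
  A-insertAt b v = sumOver-cong m (λ c → g-resp λ { zero → refl ; (suc i) → refl })

-- A strategy's comparison of x and y is query x y true; other β arise when a ball is
-- eliminated by substitute.
data ParityTree (m : ℕ) : Set where
  result : ℕ → ParityTree m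
  query  : Fin m → Fin m → Bool → ParityTree m → ParityTree m → ParityTree m

answer : ∀ {m} → Coloring m → Fin m → Fin m → Bool → Bool
answer c x y β = (c x xor c y) xor β

eval : ∀ {m} → ParityTree m → Coloring m → ℕ
eval (result r) c = r
eval (query x y β t f) c = if answer c x y β then eval t c else eval f c

queries : ∀ {m} → ParityTree m → Coloring m → ℕ
queries (result r) c = 0
queries (query x y β t f) c = suc (if answer c x y β then queries t c else queries f c)

Slack : ∀ {m} → ℕ → ParityTree m → Set
Slack {m} e T = ∀ c → queries T c + e ≤ m

module _ {m} {c d : Coloring m} (c≗d : c ≗ d) where

  answer-cong : ∀ x y β → answer c x y β ≡ answer d x y β
  answer-cong x y β = cong₂ (λ u v → (u xor v) xor β) (c≗d x) (c≗d y)

  eval-cong : ∀ T → eval T c ≡ eval T d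
  eval-cong (result r) = refl
  eval-cong (query x y β t f) = if-cong (answer-cong x y β) (eval-cong t) (eval-cong f)

  queries-cong : ∀ T → queries T c ≡ queries T d
  queries-cong (result r) = refl
  queries-cong (query x y β t f) = cong suc (if-cong (answer-cong x y β) (queries-cong t) (queries-cong f))

module _ {m m′} (ρ : Fin m → Fin m′ × Bool) where

  pullback : Coloring m′ → Coloring m
  pullback c′ a = c′ (proj₁ (ρ a)) xor proj₂ (ρ a)

  substitute : ParityTree m → ParityTree m′
  substitute (result r) = result r
  substitute (query a b β t f) =
    query (proj₁ (ρ a)) (proj₁ (ρ b)) ((proj₂ (ρ a) xor proj₂ (ρ b)) xor β) (substitute t) (substitute f)

  answer-pullback : ∀ c′ a b β →
    answer (pullback c′) a b β ≡
    answer c′ (proj₁ (ρ a)) (proj₁ (ρ b)) ((proj₂ (ρ a) xor proj₂ (ρ b)) xor β)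
  answer-pullback c′ a b β = trans
    (cong (_xor β) (xor-interchange (c′ (proj₁ (ρ a))) (proj₂ (ρ a)) (c′ (proj₁ (ρ b))) (proj₂ (ρ b))))
    (xor-assoc (c′ (proj₁ (ρ a)) xor c′ (proj₁ (ρ b))) (proj₂ (ρ a) xor proj₂ (ρ b)) β)

  eval-substitute : ∀ T c′ → eval (substitute T) c′ ≡ eval T (pullback c′)
  eval-substitute (result r) c′ = refl
  eval-substitute (query a b β t f) c′ =
    if-cong (sym (answer-pullback c′ a b β)) (eval-substitute t c′) (eval-substitute f c′)

  queries-substitute : ∀ T c′ → queries (substitute T) c′ ≡ queries T (pullback c′)
  queries-substitute (result r) c′ = refl
  queries-substitute (query a b β t f) c′ =
    cong suc (if-cong (sym (answer-pullback c′ a b β)) (queries-substitute t c′) (queries-substitute f c′))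

answer-self : ∀ {m} (c : Coloring m) x β → answer c x x β ≡ β
answer-self c x β = cong (_xor β) (xor-same (c x))

both-values : ∀ (h : Bool → ℕ) b → h true + h false ≡ h (not b) + h b
both-values h true = +-comm (h true) (h false)
both-values h false = refl

module Elimination {m} {x y : Fin (suc m)} (y≢x : y ≢ x) where

  x′ : Fin m
  x′ = punchOut y≢x

  extend : Bool → Coloring m → Coloring (suc m)
  extend s c′ = insertAt c′ y (c′ x′ xor s)

  eliminate : Bool → Fin (suc m) → Fin m × Bool
  eliminate s a with y ≟ᶠ a
  ... | yes _ = x′ , s
  ... | no y≢a = punchOut y≢a , false

  pullback-eliminate : ∀ s c′ → pullback (eliminate s) c′ ≗ extend s c′
  pullback-eliminate s c′ a with y ≟ᶠ a
  ... | yes refl = sym (insertAt-lookup c′ y _)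
  ... | no y≢a = begin
    c′ (punchOut y≢a) xor false            ≡⟨ xor-identityʳ _ ⟩
    c′ (punchOut y≢a)                      ≡⟨ insertAt-punchIn c′ y _ (punchOut y≢a) ⟨
    extend s c′ (punchIn y (punchOut y≢a)) ≡⟨ cong (extend s c′) (punchIn-punchOut y≢a) ⟩
    extend s c′ a                          ∎
    where open ≡-Reasoning

  answer-extend : ∀ s c′ β → answer (extend s c′) x y β ≡ s xor β
  answer-extend s c′ β = cong (_xor β) (begin
    extend s c′ x xor extend s c′ y  ≡⟨ cong₂ _xor_ extend-x (insertAt-lookup c′ y _) ⟩
    c′ x′ xor (c′ x′ xor s)          ≡⟨ xor-assoc (c′ x′) (c′ x′) s ⟨
    (c′ x′ xor c′ x′) xor s          ≡⟨ cong (_xor s) (xor-same (c′ x′)) ⟩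
    s                                ∎)
    where
    open ≡-Reasoning
    extend-x : extend s c′ x ≡ c′ x′
    extend-x = trans (cong (extend s c′) (sym (punchIn-punchOut y≢x))) (insertAt-punchIn c′ y _ x′)

  sumOver-extend : ∀ β T →
    sumOver (suc m) (eval T) ≡ sumOver m (eval T ∘ extend (not β)) + sumOver m (eval T ∘ extend β)
  sumOver-extend β T = begin
    sumOver (suc m) (eval T)
      ≡⟨ sumOver-insertAt m y (eval T) (λ c≗d → eval-cong c≗d T) ⟩
    sumOver m (λ c′ → eval T (insertAt c′ y true)) + sumOver m (λ c′ → eval T (insertAt c′ y false))
      ≡⟨ sumOver-+ m _ _ ⟨
    sumOver m (λ c′ → eval T (insertAt c′ y true) + eval T (insertAt c′ y false))
      ≡⟨ sumOver-cong m (λ c′ → trans (both-values (λ v → eval T (insertAt c′ y v)) (c′ x′ xor β))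
           (cong (λ v → eval T (insertAt c′ y v) + eval T (extend β c′)) (not-distribʳ-xor (c′ x′) β))) ⟩
    sumOver m (λ c′ → eval T (extend (not β) c′) + eval T (extend β c′))
      ≡⟨ sumOver-+ m _ _ ⟩
    sumOver m (eval T ∘ extend (not β)) + sumOver m (eval T ∘ extend β) ∎
    where open ≡-Reasoning

  eval-extend : ∀ s T c′ → eval T (extend s c′) ≡ eval (substitute (eliminate s) T) c′
  eval-extend s T c′ =
    trans (eval-cong (sym ∘ pullback-eliminate s c′) T) (sym (eval-substitute (eliminate s) T c′))

  queries-extend : ∀ s T c′ → queries T (extend s c′) ≡ queries (substitute (eliminate s) T) c′
  queries-extend s T c′ =
    trans (queries-cong (sym ∘ pullback-eliminate s c′) T) (sym (queries-substitute (eliminate s) T c′))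

  2^e∣sumOver-eliminate : ∀ β t f e → Slack e (query x y β t f) →
    (∀ T e → Slack e T → 2 ^ e ∣ sumOver m (eval T)) →
    2 ^ e ∣ sumOver (suc m) (eval (query x y β t f))
  2^e∣sumOver-eliminate β t f e slack 2^e∣ =
    subst (2 ^ e ∣_) (sym sumOver-split) (∣m∣n⇒∣m+n (2^e∣ t′ e slack-t′) (2^e∣ f′ e slack-f′))
    where
    T = query x y β t f
    t′ = substitute (eliminate (not β)) t
    f′ = substitute (eliminate β) f
    answer-t : ∀ c′ → answer (extend (not β) c′) x y β ≡ true
    answer-t c′ = trans (answer-extend (not β) c′ β) (xor-inverseˡ β)
    answer-f : ∀ c′ → answer (extend β c′) x y β ≡ false
    answer-f c′ = trans (answer-extend β c′ β) (xor-same β)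
    slack-t′ : Slack e t′
    slack-t′ c′ = ≤-pred (subst (λ q → suc q + e ≤ suc m)
      (trans (if-cong (answer-t c′) refl refl) (queries-extend (not β) t c′)) (slack (extend (not β) c′)))
    slack-f′ : Slack e f′
    slack-f′ c′ = ≤-pred (subst (λ q → suc q + e ≤ suc m)
      (trans (if-cong (answer-f c′) refl refl) (queries-extend β f c′)) (slack (extend β c′)))
    sumOver-split : sumOver (suc m) (eval T) ≡ sumOver m (eval t′) + sumOver m (eval f′)
    sumOver-split = trans (sumOver-extend β T) (cong₂ _+_
      (sumOver-cong m (λ c′ → trans (if-cong (answer-t c′) refl refl) (eval-extend (not β) t c′)))
      (sumOver-cong m (λ c′ → trans (if-cong (answer-f c′) refl refl) (eval-extend β f c′))))

2^e∣sumOver-repeated-query : ∀ {m} x β (t f : ParityTree m) e →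
  Slack e (query x x β t f) →
  (Slack e (if β then t else f) → 2 ^ e ∣ sumOver m (eval (if β then t else f))) →
  2 ^ e ∣ sumOver m (eval (query x x β t f))
2^e∣sumOver-repeated-query {m} x β t f e slack 2^e∣ =
  subst (2 ^ e ∣_) (sumOver-cong m (λ c → sym (eval-repeated c))) (2^e∣ (λ c → ≤-trans (n≤1+n _)
    (subst (λ q → q + e ≤ m) (queries-repeated c) (slack c))))
  where
  eval-repeated : ∀ c → eval (query x x β t f) c ≡ eval (if β then t else f) c
  eval-repeated c = trans (if-cong (answer-self c x β) refl refl) (sym (if-float (λ T → eval T c) β))
  queries-repeated : ∀ c → queries (query x x β t f) c ≡ suc (queries (if β then t else f) c)
  queries-repeated c = cong suc
    (trans (if-cong (answer-self c x β) refl refl) (sym (if-float (λ T → queries T c) β)))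

2^e∣sumOver-query : ∀ {m} x y β (t f : ParityTree (suc m)) e →
  Slack e (query x y β t f) →
  (Slack e t → 2 ^ e ∣ sumOver (suc m) (eval t)) →
  (Slack e f → 2 ^ e ∣ sumOver (suc m) (eval f)) →
  (∀ T e → Slack e T → 2 ^ e ∣ sumOver m (eval T)) →
  2 ^ e ∣ sumOver (suc m) (eval (query x y β t f))
2^e∣sumOver-query {m} x y β t f e slack 2^e∣t 2^e∣f 2^e∣ with y ≟ᶠ x
... | no y≢x = Elimination.2^e∣sumOver-eliminate y≢x β t f e slack 2^e∣
... | yes refl = 2^e∣sumOver-repeated-query x β t f e slack (2^e∣branch β)
  where
  2^e∣branch : ∀ b → Slack e (if b then t else f) →
               2 ^ e ∣ sumOver (suc m) (eval (if b then t else f))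
  2^e∣branch true = 2^e∣t
  2^e∣branch false = 2^e∣f

2^e∣sumOver-eval : ∀ m (T : ParityTree m) e → Slack e T → 2 ^ e ∣ sumOver m (eval T)
2^e∣sumOver-eval m (result r) e slack = 2^e∣sumOver-const r (slack (λ _ → true))
2^e∣sumOver-eval zero (query () _ _ _ _) e slack
2^e∣sumOver-eval (suc m) (query x y β t f) e slack =
  2^e∣sumOver-query x y β t f e slack (2^e∣sumOver-eval (suc m) t e) (2^e∣sumOver-eval (suc m) f e)
    (2^e∣sumOver-eval m)

count-tabulate : ∀ {m n} (c : Coloring n) x (h : Fin m → Fin n) →
  length (filter (λ i → c i ≟ᵇ x) (tabulate h)) ≡ count (c ∘ h) x
count-tabulate {zero} c x h = refl
count-tabulate {suc m} c x h with does (c (h zero) ≟ᵇ x)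
... | true = cong suc (trans (count-tabulate c x (h ∘ suc)) (sym (count-tabulate (c ∘ h) x suc)))
... | false = trans (count-tabulate c x (h ∘ suc)) (sym (count-tabulate (c ∘ h) x suc))

count-suc : ∀ {m} (c : Coloring (suc m)) x → count c x ≡ 𝟙 (does (c zero ≟ᵇ x)) + count (tail c) x
count-suc c x with does (c zero ≟ᵇ x)
... | true = cong suc (count-tabulate c x suc)
... | false = count-tabulate c x suc

count-true+false : ∀ {m} (c : Coloring m) → count c true + count c false ≡ m
count-true+false {zero} c = refl
count-true+false {suc m} c rewrite count-suc c true | count-suc c false with c zero
... | true = cong suc (count-true+false (tail c))
... | false = trans (+-suc (count (tail c) true) _) (cong suc (count-true+false (tail c)))

count+count-not : ∀ {m} (c : Coloring m) x → count c x + count c (not x) ≡ m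
count+count-not c true = count-true+false c
count+count-not c false = trans (+-comm (count c false) (count c true)) (count-true+false c)

at-most-one-majority : ∀ {n k} (c : Coloring n) x → n < 2 * k → k ≤ count c x → count c (not x) < k
at-most-one-majority {n} {k} c x n<2k k≤x = ≰⇒> λ k≤¬x → <⇒≱ n<2k (begin
  2 * k                         ≡⟨ cong (k +_) (+-identityʳ k) ⟩
  k + k                         ≤⟨ +-mono-≤ k≤x k≤¬x ⟩
  count c x + count c (not x)   ≡⟨ count+count-not c x ⟩
  n                             ∎)
  where open ≤-Reasoning

sumBelow : ℕ → (ℕ → ℕ) → ℕ
sumBelow zero h = 0
sumBelow (suc N) h = h 0 + sumBelow N (h ∘ suc)

sumBelow-cong : ∀ N {g h : ℕ → ℕ} → g ≗ h → sumBelow N g ≡ sumBelow N h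
sumBelow-cong zero g≗h = refl
sumBelow-cong (suc N) g≗h = cong₂ _+_ (g≗h 0) (sumBelow-cong N (g≗h ∘ suc))

sumBelow-+ : ∀ N (g h : ℕ → ℕ) → sumBelow N (λ i → g i + h i) ≡ sumBelow N g + sumBelow N h
sumBelow-+ zero g h = refl
sumBelow-+ (suc N) g h = trans (cong (g 0 + h 0 +_) (sumBelow-+ N (g ∘ suc) (h ∘ suc)))
  (+-interchange (g 0) (h 0) (sumBelow N (g ∘ suc)) (sumBelow N (h ∘ suc)))

sumBelow-vanishing : ∀ M N h → (∀ i → M ≤ i → h i ≡ 0) → M ≤ N → sumBelow N h ≡ sumBelow M h
sumBelow-vanishing zero zero h h≡0 M≤N = refl
sumBelow-vanishing zero (suc N) h h≡0 M≤N =
  cong₂ _+_ (h≡0 0 z≤n) (sumBelow-vanishing zero N (h ∘ suc) (λ i _ → h≡0 (suc i) z≤n) z≤n)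
sumBelow-vanishing (suc M) (suc N) h h≡0 (s≤s M≤N) =
  cong (h 0 +_) (sumBelow-vanishing M N (h ∘ suc) (λ i M≤i → h≡0 (suc i) (s≤s M≤i)) M≤N)

sum-map-applyUpTo : ∀ (g f : ℕ → ℕ) N → sum (map g (applyUpTo f N)) ≡ sumBelow N (g ∘ f)
sum-map-applyUpTo g f zero = refl
sum-map-applyUpTo g f (suc N) = cong (g (f 0) +_) (sum-map-applyUpTo g (f ∘ suc) N)

-- The summation range is extended to i ≤ m (the extra terms vanish), so that Pascal's rule
-- can be applied termwise.
binomTail′ : ℕ → ℕ → ℕ
binomTail′ m k = sumBelow (suc m) (λ i → m C (k + i))

binomTail≡binomTail′ : ∀ n k → binomTail n k ≡ binomTail′ n k
binomTail≡binomTail′ n k = trans (sum-map-applyUpTo (λ i → n C (k + i)) (λ i → i) (suc (n ∸ k)))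
  (sym (sumBelow-vanishing (suc (n ∸ k)) (suc n) _ beyond (s≤s (m∸n≤m n k))))
  where
  beyond : ∀ i → suc (n ∸ k) ≤ i → n C (k + i) ≡ 0
  beyond i n∸k<i = k>n⇒nCk≡0 (≤-<-trans (m≤n+m∸n n k) (+-monoʳ-< k n∸k<i))

binomTail′-suc-suc : ∀ m k → binomTail′ (suc m) (suc k) ≡ binomTail′ m k + binomTail′ m (suc k)
binomTail′-suc-suc m k = begin
  sumBelow (2 + m) (λ i → suc m C suc (k + i))
    ≡⟨ sumBelow-cong (2 + m) (λ i → sym (nCk+nC[k+1]≡[n+1]C[k+1] m (k + i))) ⟩
  sumBelow (2 + m) (λ i → m C (k + i) + m C suc (k + i))
    ≡⟨ sumBelow-+ (2 + m) (λ i → m C (k + i)) (λ i → m C suc (k + i)) ⟩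
  sumBelow (2 + m) (λ i → m C (k + i)) + sumBelow (2 + m) (λ i → m C suc (k + i))
    ≡⟨ cong₂ _+_ (sumBelow-vanishing (suc m) (2 + m) _ (beyond k) (n≤1+n _))
                 (sumBelow-vanishing (suc m) (2 + m) _ (beyond (suc k)) (n≤1+n _)) ⟩
  binomTail′ m k + binomTail′ m (suc k) ∎
  where
  open ≡-Reasoning
  beyond : ∀ j i → suc m ≤ i → m C (j + i) ≡ 0
  beyond j i m<i = k>n⇒nCk≡0 (≤-trans m<i (m≤n+m i j))

binomTail′-suc-zero : ∀ m → binomTail′ (suc m) 0 ≡ binomTail′ m 0 + binomTail′ m 0
binomTail′-suc-zero m = cong suc (begin
  sumBelow (suc m) (λ i → suc m C suc i)
    ≡⟨ sumBelow-cong (suc m) (λ i → sym (nCk+nC[k+1]≡[n+1]C[k+1] m i)) ⟩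
  sumBelow (suc m) (λ i → m C i + m C suc i)
    ≡⟨ sumBelow-+ (suc m) (m C_) (λ i → m C suc i) ⟩
  binomTail′ m 0 + sumBelow (suc m) (λ i → m C suc i)
    ≡⟨ cong (binomTail′ m 0 +_)
         (sumBelow-vanishing m (suc m) _ (λ i m≤i → k>n⇒nCk≡0 (s≤s m≤i)) (n≤1+n _)) ⟩
  binomTail′ m 0 + sumBelow m (λ i → m C suc i)
    ≡⟨ +-comm (binomTail′ m 0) _ ⟩
  sumBelow m (λ i → m C suc i) + binomTail′ m 0 ∎)
  where open ≡-Reasoning

atLeast : ∀ {m} → ℕ → Coloring m → Bool → ℕ
atLeast k c x = 𝟙 (does (k ≤? count c x))

≤?-suc : ∀ k a → does (suc k ≤? suc a) ≡ does (k ≤? a)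
≤?-suc zero a = refl
≤?-suc (suc k) a = refl

atLeast-∷-same : ∀ {m} k x (c : Coloring m) → atLeast (suc k) (x ∷ c) x ≡ atLeast k c x
atLeast-∷-same k true c =
  cong 𝟙 (trans (cong (does ∘ (suc k ≤?_)) (count-suc (true ∷ c) true)) (≤?-suc k (count c true)))
atLeast-∷-same k false c =
  cong 𝟙 (trans (cong (does ∘ (suc k ≤?_)) (count-suc (false ∷ c) false)) (≤?-suc k (count c false)))

atLeast-∷-other : ∀ {m} k x (c : Coloring m) → atLeast k (not x ∷ c) x ≡ atLeast k c x
atLeast-∷-other k true c = cong (λ a → 𝟙 (does (k ≤? a))) (count-suc (false ∷ c) true)
atLeast-∷-other k false c = cong (λ a → 𝟙 (does (k ≤? a))) (count-suc (true ∷ c) false)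

sumOver-atLeast : ∀ m k x → sumOver m (λ c → atLeast k c x) ≡ binomTail′ m k
sumOver-atLeast zero zero x = refl
sumOver-atLeast zero (suc k) x = refl
sumOver-atLeast (suc m) zero x =
  trans (cong₂ _+_ (sumOver-atLeast m 0 x) (sumOver-atLeast m 0 x)) (sym (binomTail′-suc-zero m))
sumOver-atLeast (suc m) (suc k) x = begin
  sumOver (suc m) (λ c → atLeast (suc k) c x)
    ≡⟨ sumOver-∷ m x (λ c → atLeast (suc k) c x) ⟩
  sumOver m (λ c → atLeast (suc k) (x ∷ c) x) + sumOver m (λ c → atLeast (suc k) (not x ∷ c) x)
    ≡⟨ cong₂ _+_ (sumOver-cong m (atLeast-∷-same k x)) (sumOver-cong m (atLeast-∷-other (suc k) x)) ⟩
  sumOver m (λ c → atLeast k c x) + sumOver m (λ c → atLeast (suc k) c x)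
    ≡⟨ cong₂ _+_ (sumOver-atLeast m k x) (sumOver-atLeast m (suc k) x) ⟩
  binomTail′ m k + binomTail′ m (suc k)
    ≡⟨ binomTail′-suc-suc m k ⟨
  binomTail′ (suc m) (suc k) ∎
  where open ≡-Reasoning

reportsBall : ∀ {n} → Output n → ℕ
reportsBall noMajority = 0
reportsBall (majorityBall _) = 1

reportsBall-correct : ∀ {n k} (c : Coloring n) (o : Output n) → n < 2 * k → CorrectOutput k c o →
  reportsBall o ≡ atLeast k c true + atLeast k c false
reportsBall-correct {k = k} c noMajority n<2k below = sym (cong₂ _+_
  (cong 𝟙 (dec-false (k ≤? count c true) (<⇒≱ (below true))))
  (cong 𝟙 (dec-false (k ≤? count c false) (<⇒≱ (below false)))))
reportsBall-correct {k = k} c (majorityBall b) n<2k k≤b with c b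
... | true = sym (cong₂ _+_ (cong 𝟙 (dec-true (k ≤? count c true) k≤b))
  (cong 𝟙 (dec-false (k ≤? count c false) (<⇒≱ (at-most-one-majority c true n<2k k≤b)))))
... | false = sym (cong₂ _+_
  (cong 𝟙 (dec-false (k ≤? count c true) (<⇒≱ (at-most-one-majority c false n<2k k≤b))))
  (cong 𝟙 (dec-true (k ≤? count c false) k≤b)))

toParityTree : ∀ {n} → Strategy n → ParityTree n
toParityTree (leaf o) = result (reportsBall o)
toParityTree (ask i j t f) = query i j true (toParityTree t) (toParityTree f)

same≡answer : ∀ {n} (c : Coloring n) i j → same c i j ≡ answer c i j true
same≡answer c i j with c i | c j
... | true | true = refl
... | true | false = refl
... | false | true = refl
... | false | false = refl

eval-toParityTree : ∀ {n} (T : Strategy n) c → eval (toParityTree T) c ≡ reportsBall (run T c)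
eval-toParityTree (leaf o) c = refl
eval-toParityTree (ask i j t f) c = begin
  (if answer c i j true then eval (toParityTree t) c else eval (toParityTree f) c)
    ≡⟨ if-cong (sym (same≡answer c i j)) (eval-toParityTree t c) (eval-toParityTree f c) ⟩
  (if same c i j then reportsBall (run t c) else reportsBall (run f c))
    ≡⟨ if-float reportsBall (same c i j) ⟨
  reportsBall (run (ask i j t f) c) ∎
  where open ≡-Reasoning

queries-toParityTree : ∀ {n} (T : Strategy n) c → queries (toParityTree T) c ≡ cost T c
queries-toParityTree (leaf o) c = refl
queries-toParityTree (ask i j t f) c =
  cong suc (if-cong (sym (same≡answer c i j)) (queries-toParityTree t c) (queries-toParityTree f c))

cost-cong : ∀ {n} (T : Strategy n) {c d : Coloring n} → c ≗ d → cost T c ≡ cost T d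
cost-cong T {c} {d} c≗d = begin
  cost T c                   ≡⟨ queries-toParityTree T c ⟨
  queries (toParityTree T) c ≡⟨ queries-cong c≗d (toParityTree T) ⟩
  queries (toParityTree T) d ≡⟨ queries-toParityTree T d ⟩
  cost T d                   ∎
  where open ≡-Reasoning

sumOver-reportsBall : ∀ {n k} (T : Strategy n) → Solves k T → n < 2 * k →
  sumOver n (λ c → reportsBall (run T c)) ≡ 2 * binomTail n k
sumOver-reportsBall {n} {k} T solves n<2k = begin
  sumOver n (λ c → reportsBall (run T c))
    ≡⟨ sumOver-cong n (λ c → reportsBall-correct c (run T c) n<2k (solves c)) ⟩
  sumOver n (λ c → atLeast k c true + atLeast k c false)
    ≡⟨ sumOver-+ n _ _ ⟩
  sumOver n (λ c → atLeast k c true) + sumOver n (λ c → atLeast k c false)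
    ≡⟨ cong₂ _+_ (sumOver-atLeast n k true) (sumOver-atLeast n k false) ⟩
  binomTail′ n k + binomTail′ n k
    ≡⟨ cong (λ b → b + b) (binomTail≡binomTail′ n k) ⟨
  binomTail n k + binomTail n k
    ≡⟨ cong (binomTail n k +_) (+-identityʳ (binomTail n k)) ⟨
  2 * binomTail n k ∎
  where open ≡-Reasoning

2^e∣sumOver-reportsBall : ∀ {n} (T : Strategy n) e → (∀ c → cost T c + e ≤ n) →
  2 ^ e ∣ sumOver n (λ c → reportsBall (run T c))
2^e∣sumOver-reportsBall {n} T e cheap =
  subst (2 ^ e ∣_) (sumOver-cong n (eval-toParityTree T))
    (2^e∣sumOver-eval n (toParityTree T) e
      (λ c → subst (λ q → q + e ≤ n) (sym (queries-toParityTree T c)) (cheap c)))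

∃?-Coloring : ∀ m {P : Coloring m → Set} → (∀ {c d} → c ≗ d → P c → P d) →
  (∀ c → Dec (P c)) → Dec (∃ P)
∃?-Coloring zero P-resp P? with P? []
... | yes p = yes ([] , p)
... | no ¬p = no λ (c , pc) → ¬p (P-resp (λ ()) pc)
∃?-Coloring (suc m) {P} P-resp P? =
  map′ join split
    (∃?-Coloring m (P-resp ∘ ∷-cong true) (P? ∘ (true ∷_))
       ⊎-dec ∃?-Coloring m (P-resp ∘ ∷-cong false) (P? ∘ (false ∷_)))
  where
  join : ∃ (P ∘ (true ∷_)) ⊎ ∃ (P ∘ (false ∷_)) → ∃ P
  join (inj₁ (c , p)) = true ∷ c , p
  join (inj₂ (c , p)) = false ∷ c , p
  split : ∃ P → ∃ (P ∘ (true ∷_)) ⊎ ∃ (P ∘ (false ∷_))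
  split (c , pc) with c zero in c₀
  ... | true = inj₁ (tail c , P-resp (λ { zero → c₀ ; (suc i) → refl }) pc)
  ... | false = inj₂ (tail c , P-resp (λ { zero → c₀ ; (suc i) → refl }) pc)

m<n∸1∸o⇒m+2+o≤n : ∀ m n o → m < n ∸ 1 ∸ o → m + suc (suc o) ≤ n
m<n∸1∸o⇒m+2+o≤n m n o m<n∸1∸o = subst (_≤ n) (sym (+-suc m (suc o)))
  (m≤o∸n⇒m+n≤o (suc m) 1+o≤n m<n∸[1+o])
  where
  m<n∸[1+o] : m < n ∸ suc o
  m<n∸[1+o] = subst (m <_) (∸-+-assoc n 1 o) m<n∸1∸o
  1+o≤n : suc o ≤ n
  1+o≤n = <⇒≤ (m∸n≢0⇒n<m λ n∸[1+o]≡0 → n≮0 (subst (m <_) n∸[1+o]≡0 m<n∸[1+o]))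

proposition1 : (n k : ℕ) → k ≤ n → n < 2 * k →
    (l : ℕ) → IsMu (binomTail n k) l →
    M₂≥ n k (n ∸ 1 ∸ l)
proposition1 n k _ n<2k l (_ , maximal) T solves
  with ∃?-Coloring n (λ c≗d → subst (n ∸ 1 ∸ l ≤_) (cost-cong T c≗d))
                     (λ c → n ∸ 1 ∸ l ≤? cost T c)
... | yes expensive = expensive
... | no ¬expensive = ⊥-elim (n≮n l (maximal (suc l) 2^[1+l]∣binomTail))
  where
  cheap : ∀ c → cost T c + suc (suc l) ≤ n
  cheap c = m<n∸1∸o⇒m+2+o≤n (cost T c) n l (≰⇒> λ long → ¬expensive (c , long))
  2^[1+l]∣binomTail : 2 ^ suc l ∣ binomTail n k
  2^[1+l]∣binomTail = *-cancelˡ-∣ 2 (subst (2 ^ suc (suc l) ∣_) (sumOver-reportsBall T solves n<2k)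
    (2^e∣sumOver-reportsBall T (suc (suc l)) cheap))
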